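{- For all integers $k \geq 2$, the graphs $K_{2k-1}$ and $K_{2k-1}^-$ have a fractional $K_k$-decomposition.
   Context: $K_t$ is the complete graph on $t$ vertices and $K_t^-$ is $K_t$ with one edge removed. For a fixed graph $H$, a fractional $H$-decomposition of a graph $G$ is an assignment of nonnegative real weights to the copies of $H$ in $G$ such that for each edge $e \in E(G)$, the sum of the weights of the copies of $H$ containing $e$ is exactly one. -}

module Defs where

open import Data.Nat using (ℕ; zero; suc; _≡ᵇ_)
open import Data.Bool using (Bool; true; false; _∧_; _∨_; not; T; if_then_else_)
open import Data.Fin using (Fin; zero; suc; toℕ; _<_)
open import Data.Fin.Subset using (Subset; ∣_∣; _∈_)
open import Data.Vec using ([]; _∷_; lookup)
open import Data.List using (List; []; _∷_; map; _++_)
open import Data.Rational using (ℚ; 0ℚ; 1ℚ; _+_; _≤_)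
open import Data.Product using (Σ; _×_)
open import Relation.Nullary using (¬_)
open import Relation.Binary.PropositionalEquality using (_≡_)

-- A (simple) graph on vertex set Fin n, given by a Boolean adjacency
-- relation.  All graphs used below are symmetric and loopless; the
-- edges are the pairs i < j with T (adj i j).
Graph : ℕ → Set
Graph n = Fin n → Fin n → Bool

_=ᶠ_ : ∀ {n} → Fin n → Fin n → Bool
i =ᶠ j = toℕ i ≡ᵇ toℕ j

complete : (n : ℕ) → Graph n
complete n i j = not (i =ᶠ j)

completeMinus : (n : ℕ) → Graph n
completeMinus n i j =
  not (i =ᶠ j) ∧
  not (((toℕ i ≡ᵇ 0) ∧ (toℕ j ≡ᵇ 1)) ∨ ((toℕ i ≡ᵇ 1) ∧ (toℕ j ≡ᵇ 0)))

-- A copy of K_k in G is determined by its vertex set: a k-element set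
-- of vertices which are pairwise adjacent in G.
IsCopyOfK : ∀ {n} → ℕ → Graph n → Subset n → Set
IsCopyOfK k G S =
  ∣ S ∣ ≡ k × (∀ i j → i ∈ S → j ∈ S → i < j → T (G i j))

allSubsets : (n : ℕ) → List (Subset n)
allSubsets zero = [] ∷ []
allSubsets (suc n) = map (false ∷_) (allSubsets n) ++ map (true ∷_) (allSubsets n)

sumℚ : List ℚ → ℚ
sumℚ [] = 0ℚ
sumℚ (x ∷ xs) = x + sumℚ xs

sumContaining : ∀ {n} → (Subset n → ℚ) → Fin n → Fin n → ℚ
sumContaining {n} w i j =
  sumℚ (map (λ S → if lookup S i ∧ lookup S j then w S else 0ℚ) (allSubsets n))

HasFracKDecomp : ∀ {n} → ℕ → Graph n → Set
HasFracKDecomp {n} k G =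
  Σ (Subset n → ℚ) λ w →
    (∀ S → 0ℚ ≤ w S) ×
    (∀ S → ¬ IsCopyOfK k G S → w S ≡ 0ℚ) ×
    (∀ i j → i < j → T (G i j) → sumContaining w i j ≡ 1ℚ)

-- Weight uniformly a family of k-cliques in which every edge lies in the same
-- number N of members, giving each the weight 1/N.  For K_n take all k-sets:
-- an edge lies in C(n-2,k-2) of them.  For K_n^- with the edge 01 missing take
-- the k-sets containing exactly one of 0 and 1: an edge at 0 or 1 lies in
-- C(n-3,k-2) of them and any other edge in 2 C(n-4,k-3).  These agree for
-- n = 2k-1, where C(2k-4,k-2) = C(2k-5,k-3) + C(2k-5,k-2) and the two
-- summands are equal by symmetry.

module Submission where

open import Defs
open import Data.Nat using (ℕ; _≤_; _*_; _∸_)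
open import Data.Product using (_×_; _,_)

open import Algebra.Bundles using (CommutativeRing)
open import Data.Bool using (Bool; true; false; _∧_; _xor_; T; if_then_else_)
open import Data.Bool.Properties using (∧-zeroʳ; ∧-assoc; T-∧)
open import Data.Empty using (⊥; ⊥-elim)
open import Data.Fin as Fin using (Fin; zero; suc; toℕ; punchOut)
open import Data.Fin.Properties using (<⇒≢; punchIn-punchOut)
open import Data.Fin.Subset using (Subset; ∣_∣; _∈_)
open import Data.List using ([]; _∷_; map; _++_)
open import Data.List.Properties using (map-++; map-∘; map-cong)
open import Data.Nat as ℕ using (zero; suc; z≤n; s≤s; _+_; _<_; _≡ᵇ_; NonZero)
open import Data.Nat.Combinatorics
  using (_C_; k>n⇒nCk≡0; nCk+nC[k+1]≡[n+1]C[k+1]; nCk≡nC[n∸k]; nCn≡1)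
import Data.Nat.Properties as ℕ
import Data.Rational as ℚ
open import Data.Rational using (ℚ; 0ℚ; 1ℚ; 1/_; Positive; NonNegative)
import Data.Rational.Properties as ℚ
open import Data.Vec using ([]; _∷_; lookup; insertAt)
open import Data.Vec.Properties using (insertAt-punchIn; []=⇒lookup)
open import Function using (_∘_; Equivalence)
open import Relation.Nullary using (¬_)
open import Relation.Binary.PropositionalEquality
open import Algebra.Properties.Semiring.Mult (CommutativeRing.semiring ℚ.+-*-commutativeRing)
  using (×-homo-+; ×-assoc-*) renaming (_×_ to _×ℚ_)

n×1-nonNegative : ∀ n → NonNegative (n ×ℚ 1ℚ)
n×1-nonNegative zero    = _
n×1-nonNegative (suc n) = ℚ.nonNeg+nonNeg⇒nonNeg 1ℚ (n ×ℚ 1ℚ) {{n×1-nonNegative n}}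

n×1-positive : ∀ n .{{_ : NonZero n}} → Positive (n ×ℚ 1ℚ)
n×1-positive (suc n) = ℚ.pos+nonNeg⇒pos 1ℚ (n ×ℚ 1ℚ) {{n×1-nonNegative n}}

instance
  n×1-nonZero : ∀ {n} .{{_ : NonZero n}} → ℚ.NonZero (n ×ℚ 1ℚ)
  n×1-nonZero {n} = ℚ.pos⇒nonZero (n ×ℚ 1ℚ) {{n×1-positive n}}

1/[n×1]-nonNegative : ∀ n .{{_ : NonZero n}} → 0ℚ ℚ.≤ 1/ (n ×ℚ 1ℚ)
1/[n×1]-nonNegative n = ℚ.nonNegative⁻¹ (1/ (n ×ℚ 1ℚ))
  {{ℚ.pos⇒nonNeg (1/ (n ×ℚ 1ℚ)) {{ℚ.1/pos⇒pos (n ×ℚ 1ℚ) {{n×1-positive n}}}}}}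

n×1/[n×1]≡1 : ∀ n .{{_ : NonZero n}} → n ×ℚ 1/ (n ×ℚ 1ℚ) ≡ 1ℚ
n×1/[n×1]≡1 n = begin
  n ×ℚ 1/ (n ×ℚ 1ℚ)          ≡⟨ cong (n ×ℚ_) (ℚ.*-identityˡ _) ⟨
  n ×ℚ (1ℚ ℚ.* 1/ (n ×ℚ 1ℚ)) ≡⟨ ×-assoc-* n 1ℚ _ ⟨
  (n ×ℚ 1ℚ) ℚ.* 1/ (n ×ℚ 1ℚ) ≡⟨ ℚ.*-inverseʳ (n ×ℚ 1ℚ) ⟩
  1ℚ                         ∎
  where open ≡-Reasoning

countSubsets : ∀ n → (Subset n → Bool) → ℕ
countSubsets zero    P = if P [] then 1 else 0
countSubsets (suc n) P = countSubsets n (P ∘ (false ∷_)) + countSubsets n (P ∘ (true ∷_))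

countSubsets-cong : ∀ n {P Q : Subset n → Bool} → P ≗ Q → countSubsets n P ≡ countSubsets n Q
countSubsets-cong zero    P≗Q rewrite P≗Q [] = refl
countSubsets-cong (suc n) P≗Q =
  cong₂ _+_ (countSubsets-cong n (P≗Q ∘ (false ∷_))) (countSubsets-cong n (P≗Q ∘ (true ∷_)))

countSubsets-false : ∀ n → countSubsets n (λ _ → false) ≡ 0
countSubsets-false zero    = refl
countSubsets-false (suc n) = cong₂ _+_ (countSubsets-false n) (countSubsets-false n)

countSubsets-∧false : ∀ n (P : Subset n → Bool) → countSubsets n (λ S → P S ∧ false) ≡ 0
countSubsets-∧false n P = trans (countSubsets-cong n (∧-zeroʳ ∘ P)) (countSubsets-false n)

sumℚ-++ : ∀ xs ys → sumℚ (xs ++ ys) ≡ sumℚ xs ℚ.+ sumℚ ys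
sumℚ-++ []       ys = sym (ℚ.+-identityˡ (sumℚ ys))
sumℚ-++ (x ∷ xs) ys =
  trans (cong (x ℚ.+_) (sumℚ-++ xs ys)) (sym (ℚ.+-assoc x (sumℚ xs) (sumℚ ys)))

uniformOn : ∀ {n} → (Subset n → Bool) → ℚ → Subset n → ℚ
uniformOn Q c S = if Q S then c else 0ℚ

sum-uniformOn : ∀ n (Q : Subset n → Bool) c →
  sumℚ (map (uniformOn Q c) (allSubsets n)) ≡ countSubsets n Q ×ℚ c
sum-uniformOn zero Q c with Q []
... | true  = refl
... | false = refl
sum-uniformOn (suc n) Q c = begin
  sumℚ (map w (map (false ∷_) Ss ++ map (true ∷_) Ss))
    ≡⟨ cong sumℚ (map-++ w (map (false ∷_) Ss) (map (true ∷_) Ss)) ⟩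
  sumℚ (map w (map (false ∷_) Ss) ++ map w (map (true ∷_) Ss))
    ≡⟨ sumℚ-++ (map w (map (false ∷_) Ss)) (map w (map (true ∷_) Ss)) ⟩
  sumℚ (map w (map (false ∷_) Ss)) ℚ.+ sumℚ (map w (map (true ∷_) Ss))
    ≡⟨ cong₂ ℚ._+_ (cong sumℚ (map-∘ Ss)) (cong sumℚ (map-∘ Ss)) ⟨
  sumℚ (map (uniformOn Q₀ c) Ss) ℚ.+ sumℚ (map (uniformOn Q₁ c) Ss)
    ≡⟨ cong₂ ℚ._+_ (sum-uniformOn n Q₀ c) (sum-uniformOn n Q₁ c) ⟩
  countSubsets n Q₀ ×ℚ c ℚ.+ countSubsets n Q₁ ×ℚ c
    ≡⟨ ×-homo-+ c (countSubsets n Q₀) (countSubsets n Q₁) ⟨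
  countSubsets (suc n) Q ×ℚ c ∎
  where
    open ≡-Reasoning
    w = uniformOn Q c
    Ss = allSubsets n
    Q₀ Q₁ : Subset n → Bool
    Q₀ = Q ∘ (false ∷_)
    Q₁ = Q ∘ (true ∷_)

countContaining : ∀ {n} → (Subset n → Bool) → Fin n → Fin n → ℕ
countContaining {n} Q i j = countSubsets n (λ S → (lookup S i ∧ lookup S j) ∧ Q S)

sumContaining-uniformOn : ∀ {n} (Q : Subset n → Bool) c i j →
  sumContaining (uniformOn Q c) i j ≡ countContaining Q i j ×ℚ c
sumContaining-uniformOn {n} Q c i j =
  trans (cong sumℚ (map-cong (λ S → if-∧ (lookup S i ∧ lookup S j) (Q S)) (allSubsets n)))
        (sum-uniformOn n (λ S → (lookup S i ∧ lookup S j) ∧ Q S) c)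
  where
    if-∧ : ∀ a b → (if a then (if b then c else 0ℚ) else 0ℚ) ≡ (if a ∧ b then c else 0ℚ)
    if-∧ true  b = refl
    if-∧ false b = refl

uniformOn-hasFracKDecomp : ∀ {n} k (G : Graph n) (Q : Subset n → Bool) N .{{_ : NonZero N}} →
  (∀ S → T (Q S) → IsCopyOfK k G S) →
  (∀ i j → i Fin.< j → T (G i j) → countContaining Q i j ≡ N) →
  HasFracKDecomp k G
uniformOn-hasFracKDecomp k G Q N copy regular = uniformOn Q c , nonNegative , offCopies , covers
  where
    c = 1/ (N ×ℚ 1ℚ)

    nonNegative : ∀ S → 0ℚ ℚ.≤ uniformOn Q c S
    nonNegative S with Q S
    ... | true  = 1/[n×1]-nonNegative N
    ... | false = ℚ.≤-refl

    offCopies : ∀ S → ¬ IsCopyOfK k G S → uniformOn Q c S ≡ 0ℚ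
    offCopies S notCopy with Q S in QS
    ... | true  = ⊥-elim (notCopy (copy S (subst T (sym QS) _)))
    ... | false = refl

    covers : ∀ i j → i Fin.< j → T (G i j) → sumContaining (uniformOn Q c) i j ≡ 1ℚ
    covers i j i<j ij∈G = begin
      sumContaining (uniformOn Q c) i j ≡⟨ sumContaining-uniformOn Q c i j ⟩
      countContaining Q i j ×ℚ c        ≡⟨ cong (_×ℚ c) (regular i j i<j ij∈G) ⟩
      N ×ℚ c                            ≡⟨ n×1/[n×1]≡1 N ⟩
      1ℚ                                ∎
      where open ≡-Reasoning

nC0≡1 : ∀ n → n C 0 ≡ 1
nC0≡1 n = trans (nCk≡nC[n∸k] {0} {n} z≤n) (nCn≡1 n)

nCk>0 : ∀ {n k} → k ≤ n → 0 < n C k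
nCk>0 {n}     {zero}  _         = ℕ.≤-reflexive (sym (nC0≡1 n))
nCk>0 {suc n} {suc k} (s≤s k≤n) = begin-strict
  0                     <⟨ nCk>0 k≤n ⟩
  n C k                 ≤⟨ ℕ.m≤m+n (n C k) (n C suc k) ⟩
  n C k + n C suc k     ≡⟨ nCk+nC[k+1]≡[n+1]C[k+1] n k ⟩
  suc n C suc k         ∎
  where open ℕ.≤-Reasoning

[2+2n]C[1+n]≡[1+2n]Cn+[1+2n]Cn : ∀ n → (suc n + suc n) C suc n ≡ (n + suc n) C n + (n + suc n) C n
[2+2n]C[1+n]≡[1+2n]Cn+[1+2n]Cn n = begin
  suc (n + suc n) C suc n                       ≡⟨ nCk+nC[k+1]≡[n+1]C[k+1] (n + suc n) n ⟨
  (n + suc n) C n + (n + suc n) C suc n         ≡⟨ cong ((n + suc n) C n +_) middle-symmetry ⟩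
  (n + suc n) C n + (n + suc n) C n             ∎
  where
    open ≡-Reasoning
    middle-symmetry : (n + suc n) C suc n ≡ (n + suc n) C n
    middle-symmetry = trans (nCk≡nC[n∸k] {suc n} {n + suc n} (ℕ.m≤n+m (suc n) n))
                            (cong ((n + suc n) C_) (ℕ.m+n∸n≡m n (suc n)))

hasSize : ∀ {n} → ℕ → Subset n → Bool
hasSize k S = ∣ S ∣ ≡ᵇ k

countSubsets-hasSize : ∀ n k → countSubsets n (hasSize k) ≡ n C k
countSubsets-hasSize zero    zero    = refl
countSubsets-hasSize zero    (suc k) = sym (k>n⇒nCk≡0 {0} {suc k} (s≤s z≤n))
countSubsets-hasSize (suc n) zero    = begin
  countSubsets n (hasSize 0) + countSubsets n (λ _ → false)
    ≡⟨ cong₂ _+_ (countSubsets-hasSize n 0) (countSubsets-false n) ⟩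
  n C 0 + 0     ≡⟨ ℕ.+-identityʳ (n C 0) ⟩
  n C 0         ≡⟨ trans (nC0≡1 n) (sym (nC0≡1 (suc n))) ⟩
  suc n C 0     ∎
  where open ≡-Reasoning
countSubsets-hasSize (suc n) (suc k) = begin
  countSubsets n (hasSize (suc k)) + countSubsets n (hasSize k)
    ≡⟨ cong₂ _+_ (countSubsets-hasSize n (suc k)) (countSubsets-hasSize n k) ⟩
  n C suc k + n C k     ≡⟨ ℕ.+-comm (n C suc k) (n C k) ⟩
  n C k + n C suc k     ≡⟨ nCk+nC[k+1]≡[n+1]C[k+1] n k ⟩
  suc n C suc k         ∎
  where open ≡-Reasoning

countSubsets-∋ : ∀ n (i : Fin (suc n)) (P : Subset (suc n) → Bool) →
  countSubsets (suc n) (λ S → lookup S i ∧ P S) ≡ countSubsets n (λ S → P (insertAt S i true))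
countSubsets-∋ n       zero    P = cong (_+ countSubsets n (P ∘ (true ∷_))) (countSubsets-false n)
countSubsets-∋ (suc n) (suc i) P =
  cong₂ _+_ (countSubsets-∋ n i (P ∘ (false ∷_))) (countSubsets-∋ n i (P ∘ (true ∷_)))

∣insertAt-inside∣ : ∀ {n} (S : Subset n) i → ∣ insertAt S i true ∣ ≡ suc ∣ S ∣
∣insertAt-inside∣ S           zero    = refl
∣insertAt-inside∣ (false ∷ S) (suc i) = ∣insertAt-inside∣ S i
∣insertAt-inside∣ (true ∷ S)  (suc i) = cong suc (∣insertAt-inside∣ S i)

hasSize-insertAt : ∀ {n} k (S : Subset n) i → hasSize (suc k) (insertAt S i true) ≡ hasSize k S
hasSize-insertAt k S i = cong (_≡ᵇ suc k) (∣insertAt-inside∣ S i)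

countSubsets-∋-hasSize : ∀ n (i : Fin (suc n)) k →
  countSubsets (suc n) (λ S → lookup S i ∧ hasSize (suc k) S) ≡ n C k
countSubsets-∋-hasSize n i k = begin
  countSubsets (suc n) (λ S → lookup S i ∧ hasSize (suc k) S)
    ≡⟨ countSubsets-∋ n i (hasSize (suc k)) ⟩
  countSubsets n (λ S → hasSize (suc k) (insertAt S i true))
    ≡⟨ countSubsets-cong n (λ S → hasSize-insertAt k S i) ⟩
  countSubsets n (hasSize k)
    ≡⟨ countSubsets-hasSize n k ⟩
  n C k ∎
  where open ≡-Reasoning

countContaining-hasSize : ∀ n {i j : Fin (suc (suc n))} → i ≢ j → ∀ k →
  countContaining (hasSize (suc (suc k))) i j ≡ n C k
countContaining-hasSize n {i} {j} i≢j k = begin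
  countSubsets (2 + n) (λ S → (lookup S i ∧ lookup S j) ∧ hasSize (2 + k) S)
    ≡⟨ countSubsets-cong (2 + n) (λ S → ∧-assoc (lookup S i) (lookup S j) (hasSize (2 + k) S)) ⟩
  countSubsets (2 + n) (λ S → lookup S i ∧ (lookup S j ∧ hasSize (2 + k) S))
    ≡⟨ countSubsets-∋ (suc n) i (λ S → lookup S j ∧ hasSize (2 + k) S) ⟩
  countSubsets (suc n) (λ S → lookup (insertAt S i true) j ∧ hasSize (2 + k) (insertAt S i true))
    ≡⟨ countSubsets-cong (suc n) (λ S →
         cong₂ _∧_ (lookup-insertAt S) (hasSize-insertAt (suc k) S i)) ⟩
  countSubsets (suc n) (λ S → lookup S (punchOut i≢j) ∧ hasSize (suc k) S)
    ≡⟨ countSubsets-∋-hasSize n (punchOut i≢j) k ⟩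
  n C k ∎
  where
    open ≡-Reasoning
    lookup-insertAt : ∀ S → lookup (insertAt S i true) j ≡ lookup S (punchOut i≢j)
    lookup-insertAt S = trans (cong (lookup (insertAt S i true)) (sym (punchIn-punchOut i≢j)))
                              (insertAt-punchIn S i true (punchOut i≢j))

<⇒complete : ∀ {n} {i j : Fin n} → i Fin.< j → T (complete n i j)
<⇒complete {i = i} {j} i<j with toℕ i ≡ᵇ toℕ j in i≡ᵇj
... | true  = ℕ.<⇒≢ i<j (ℕ.≡ᵇ⇒≡ (toℕ i) (toℕ j) (subst T (sym i≡ᵇj) _))
... | false = _

complete-hasFracKDecomp : ∀ {n k} → 2 ≤ k → k ≤ n → HasFracKDecomp k (complete n)
complete-hasFracKDecomp {suc (suc m)} {suc (suc k)} (s≤s (s≤s z≤n)) (s≤s (s≤s k≤m)) =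
  uniformOn-hasFracKDecomp (2 + k) (complete (2 + m)) (hasSize (2 + k))
    (m C k) {{ℕ.>-nonZero (nCk>0 k≤m)}}
    (λ S size → ℕ.≡ᵇ⇒≡ ∣ S ∣ (2 + k) size , λ _ _ _ _ → <⇒complete)
    (λ i j i<j _ → countContaining-hasSize m (<⇒≢ i<j) k)

exactlyOneOf01 : ∀ {m} → Subset (2 + m) → Bool
exactlyOneOf01 S = lookup S zero xor lookup S (suc zero)

notBoth : ∀ {a b} → T (a xor b) → a ≡ true → b ≡ true → ⊥
notBoth one refl refl = one

exactlyOneOf01⇒clique : ∀ {m} (S : Subset (2 + m)) → T (exactlyOneOf01 S) →
  ∀ i j → i ∈ S → j ∈ S → i Fin.< j → T (completeMinus (2 + m) i j)
exactlyOneOf01⇒clique S one zero          (suc zero)     i∈S j∈S _ =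
  ⊥-elim (notBoth one ([]=⇒lookup i∈S) ([]=⇒lookup j∈S))
exactlyOneOf01⇒clique S one zero          (suc (suc r))  _   _   _ = _
exactlyOneOf01⇒clique S one (suc zero)    (suc zero)     _   _   (s≤s ())
exactlyOneOf01⇒clique S one (suc zero)    (suc (suc r))  _   _   _ = _
exactlyOneOf01⇒clique S one (suc (suc r)) (suc (suc r′)) _   _   (s≤s (s≤s r<r′)) =
  Equivalence.from T-∧ (<⇒complete {i = r} {r′} r<r′ , _)

oneOf01OfSize : ∀ {m} → ℕ → Subset (2 + m) → Bool
oneOf01OfSize k S = exactlyOneOf01 S ∧ hasSize k S

-- countSubsets (2 + m) unfolds to four counts over Subset m, one for each
-- choice of the memberships of 0 and 1 (in the order 00, 01, 10, 11).
completeMinus-regular : ∀ t (u v : Fin (3 + (t + t))) → u Fin.< v →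
  T (completeMinus (3 + (t + t)) u v) → countContaining (oneOf01OfSize (2 + t)) u v ≡ (t + t) C t
completeMinus-regular t zero (suc (suc r)) _ _ = trans
  (cong₂ _+_ (cong₂ _+_ (countSubsets-false m) (countSubsets-false m))
             (cong₂ _+_ (countSubsets-∋-hasSize (t + t) r t) (countSubsets-∧false m (λ S → lookup S r))))
  (ℕ.+-identityʳ ((t + t) C t))
  where m = suc (t + t)
completeMinus-regular t (suc zero) (suc (suc r)) _ _ = trans
  (cong₂ _+_ (cong₂ _+_ (countSubsets-false m) (countSubsets-∋-hasSize (t + t) r t))
             (cong₂ _+_ (countSubsets-false m) (countSubsets-∧false m (λ S → lookup S r))))
  (ℕ.+-identityʳ ((t + t) C t))
  where m = suc (t + t)
completeMinus-regular zero (suc (suc zero)) (suc (suc zero)) (s≤s (s≤s ())) _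
completeMinus-regular (suc s) (suc (suc r)) (suc (suc r′)) (s≤s (s≤s r<r′)) _ = begin
  countContaining (oneOf01OfSize (3 + s)) (suc (suc r)) (suc (suc r′))
    ≡⟨ cong₂ _+_ (cong₂ _+_ (countSubsets-∧false m ∋r,r′) countContaining-r,r′)
                 (cong₂ _+_ countContaining-r,r′ (countSubsets-∧false m ∋r,r′)) ⟩
  x + (x + 0)                ≡⟨ cong (x +_) (ℕ.+-identityʳ x) ⟩
  x + x                      ≡⟨ [2+2n]C[1+n]≡[1+2n]Cn+[1+2n]Cn s ⟨
  (suc s + suc s) C suc s    ∎
  where
    open ≡-Reasoning
    m = 2 + (s + suc s)
    x = (s + suc s) C s
    ∋r,r′ : Subset m → Bool
    ∋r,r′ S = lookup S r ∧ lookup S r′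
    countContaining-r,r′ : countContaining (hasSize (2 + s)) r r′ ≡ x
    countContaining-r,r′ = countContaining-hasSize (s + suc s) (<⇒≢ {i = r} {r′} r<r′) s

completeMinus-hasFracKDecomp : ∀ t → HasFracKDecomp (2 + t) (completeMinus (3 + (t + t)))
completeMinus-hasFracKDecomp t =
  uniformOn-hasFracKDecomp (2 + t) (completeMinus (3 + (t + t))) (oneOf01OfSize (2 + t))
    ((t + t) C t) {{ℕ.>-nonZero (nCk>0 (ℕ.m≤n+m t t))}}
    (λ S one∧size → let (one , size) = Equivalence.to T-∧ one∧size in
                    ℕ.≡ᵇ⇒≡ ∣ S ∣ (2 + t) size , exactlyOneOf01⇒clique S one)
    (completeMinus-regular t)

2[2+t]∸1≡3+[t+t] : ∀ t → 2 * (2 + t) ∸ 1 ≡ 3 + (t + t)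
2[2+t]∸1≡3+[t+t] t = cong suc (begin
  t + suc (suc (t + 0)) ≡⟨ ℕ.+-suc t (suc (t + 0)) ⟩
  suc (t + suc (t + 0)) ≡⟨ cong suc (ℕ.+-suc t (t + 0)) ⟩
  2 + (t + (t + 0))     ≡⟨ cong (λ u → 2 + (t + u)) (ℕ.+-identityʳ t) ⟩
  2 + (t + t)           ∎)
  where open ≡-Reasoning

lemma2p2 : ∀ (k : ℕ) → 2 ≤ k →
    HasFracKDecomp k (complete (2 * k ∸ 1)) × HasFracKDecomp k (completeMinus (2 * k ∸ 1))
lemma2p2 k@(suc (suc t)) 2≤k@(s≤s (s≤s z≤n)) =
  subst (λ n → HasFracKDecomp k (complete n) × HasFracKDecomp k (completeMinus n))
        (sym (2[2+t]∸1≡3+[t+t] t))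
        (complete-hasFracKDecomp 2≤k (s≤s (s≤s (ℕ.m≤n⇒m≤1+n (ℕ.m≤m+n t t)))) ,
         completeMinus-hasFracKDecomp t)
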